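{- For every finite multiset $\Gamma$ of formulas and every formula $E$: $\Gamma\Rightarrow E$ is derivable in $\mathsf{GWFD}$ if and only if $\vdash_{\mathsf{WFD}}\bigwedge\Gamma\rightarrow E$.
   Context: Formulas are built from a countable set of propositional atoms and $\bot$ using $\wedge,\vee,\rightarrow$; $A\leftrightarrow B$ abbreviates $(A\rightarrow B)\wedge(B\rightarrow A)$. $\bigwedge\Gamma$ is the conjunction of the formulas of $\Gamma$ (empty conjunction read as $\bot\rightarrow\bot$). Sequent calculus $\mathsf{GWFD}$ (sequents $\Gamma\Rightarrow C$, $\Gamma$ finite multiset, $C$ a formula, $p$ atomic): (Ax) $p,\Gamma\Rightarrow p$; ($\bot_L$) $\bot,\Gamma\Rightarrow C$; ($\wedge_L$) from $A,B,\Gamma\Rightarrow C$ infer $A\wedge B,\Gamma\Rightarrow C$; ($\wedge_R$) from $\Gamma\Rightarrow A$ and $\Gamma\Rightarrow B$ infer $\Gamma\Rightarrow A\wedge B$; ($\vee_L$) from $A,\Gamma\Rightarrow C$ and $B,\Gamma\Rightarrow C$ infer $A\vee B,\Gamma\Rightarrow C$; ($\vee_R^1$) from $\Gamma\Rightarrow A$ infer $\Gamma\Rightarrow A\vee B$; ($\vee_R^2$) from $\Gamma\Rightarrow B$ infer $\Gamma\Rightarrow A\vee B$; ($\rightarrow_R$) from $A\Rightarrow B$ infer $\Gamma\Rightarrow A\rightarrow B$; ($\rightarrow_{LR}$) from $A\Rightarrow B$, $B\Rightarrow A$, $C\Rightarrow D$, $D\Rightarrow C$ infer $\Gamma,A\rightarrow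 C\Rightarrow B\rightarrow D$; ($\rightarrow_D$) from $\Gamma\Rightarrow B\rightarrow C$ and $\Gamma\Rightarrow D\rightarrow C$ infer $\Gamma\Rightarrow B\vee D\rightarrow C$; (Cut) from $\Gamma\Rightarrow D$ and $D,\Gamma'\Rightarrow E$ infer $\Gamma,\Gamma'\Rightarrow E$. Hilbert system $\mathsf{WF}$: axioms all instances of $A\rightarrow(A\vee B)$; $B\rightarrow(A\vee B)$; $(A\wedge B)\rightarrow A$; $(A\wedge B)\rightarrow B$; $A\wedge(B\vee C)\rightarrow(A\wedge B)\vee(A\wedge C)$; $A\rightarrow A$; $\bot\rightarrow A$; rules: from $A$, $A\rightarrow B$ infer $B$; from $A$ infer $B\rightarrow A$; from $A\rightarrow B$, $B\rightarrow C$ infer $A\rightarrow C$; from $A\rightarrow B$, $A\rightarrow C$ infer $A\rightarrow(B\wedge C)$; from $A\rightarrow C$, $B\rightarrow C$ infer $(A\vee B)\rightarrow C$; from $A$, $B$ infer $A\wedge B$; from $A\leftrightarrow B$, $C\leftrightarrow D$ infer $(A\rightarrow C)\leftrightarrow(B\rightarrow D)$. $\mathsf{WFD}$ is $\mathsf{WF}$ plus all instances of the axiom $(A\rightarrow C)\wedge(B\rightarrow C)\rightarrow(A\vee B\rightarrow C)$. -}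

module Defs where

open import Data.Nat using (ℕ)
open import Data.List using (List; []; _∷_; _++_)
open import Data.List.Relation.Binary.Permutation.Propositional using (_↭_)

infixr 6 _∧_
infixr 5 _∨_
infixr 4 _⇒_
infix 3.5 _⟺_

data Formula : Set where
  atom : ℕ → Formula
  ⊥′   : Formula
  _∧_  : Formula → Formula → Formula
  _∨_  : Formula → Formula → Formula
  _⇒_  : Formula → Formula → Formula

_⟺_ : Formula → Formula → Formula
A ⟺ B = (A ⇒ B) ∧ (B ⇒ A)

⋀ : List Formula → Formula
⋀ []           = ⊥′ ⇒ ⊥′
⋀ (A ∷ [])     = A
⋀ (A ∷ B ∷ Γ)  = A ∧ ⋀ (B ∷ Γ)

-- Sequent calculus GWFD. Multisets are represented by lists; the rule
-- 'perm' identifies lists that are permutations of one another, so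
-- derivability is a property of the underlying multiset.
infix 3 _⊢G_
data _⊢G_ : List Formula → Formula → Set where
  perm  : ∀ {Γ Δ C} → Γ ↭ Δ → Γ ⊢G C → Δ ⊢G C
  ax    : ∀ {p Γ} → (atom p ∷ Γ) ⊢G atom p
  ⊥L    : ∀ {Γ C} → (⊥′ ∷ Γ) ⊢G C
  ∧L    : ∀ {A B Γ C} → (A ∷ B ∷ Γ) ⊢G C → ((A ∧ B) ∷ Γ) ⊢G C
  ∧R    : ∀ {Γ A B} → Γ ⊢G A → Γ ⊢G B → Γ ⊢G (A ∧ B)
  ∨L    : ∀ {A B Γ C} → (A ∷ Γ) ⊢G C → (B ∷ Γ) ⊢G C → ((A ∨ B) ∷ Γ) ⊢G C
  ∨R₁   : ∀ {Γ A B} → Γ ⊢G A → Γ ⊢G (A ∨ B)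
  ∨R₂   : ∀ {Γ A B} → Γ ⊢G B → Γ ⊢G (A ∨ B)
  ⇒R    : ∀ {Γ A B} → (A ∷ []) ⊢G B → Γ ⊢G (A ⇒ B)
  ⇒LR   : ∀ {Γ A B C D} →
          (A ∷ []) ⊢G B → (B ∷ []) ⊢G A →
          (C ∷ []) ⊢G D → (D ∷ []) ⊢G C →
          ((A ⇒ C) ∷ Γ) ⊢G (B ⇒ D)
  ⇒D    : ∀ {Γ B C D} → Γ ⊢G (B ⇒ C) → Γ ⊢G (D ⇒ C) → Γ ⊢G ((B ∨ D) ⇒ C)
  cut   : ∀ {Γ Γ′ D E} → Γ ⊢G D → (D ∷ Γ′) ⊢G E → (Γ ++ Γ′) ⊢G E

-- Hilbert system WF, and WFD = WF + axiom D.
infix 3 ⊢WFD_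
data ⊢WFD_ : Formula → Set where
  a∨₁   : ∀ {A B} → ⊢WFD A ⇒ (A ∨ B)
  a∨₂   : ∀ {A B} → ⊢WFD B ⇒ (A ∨ B)
  a∧₁   : ∀ {A B} → ⊢WFD (A ∧ B) ⇒ A
  a∧₂   : ∀ {A B} → ⊢WFD (A ∧ B) ⇒ B
  adist : ∀ {A B C} → ⊢WFD (A ∧ (B ∨ C)) ⇒ ((A ∧ B) ∨ (A ∧ C))
  aid   : ∀ {A} → ⊢WFD A ⇒ A
  a⊥    : ∀ {A} → ⊢WFD ⊥′ ⇒ A
  aD    : ∀ {A B C} → ⊢WFD ((A ⇒ C) ∧ (B ⇒ C)) ⇒ ((A ∨ B) ⇒ C)
  mp    : ∀ {A B} → ⊢WFD A → ⊢WFD A ⇒ B → ⊢WFD B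
  weak  : ∀ {A B} → ⊢WFD A → ⊢WFD B ⇒ A
  trans : ∀ {A B C} → ⊢WFD A ⇒ B → ⊢WFD B ⇒ C → ⊢WFD A ⇒ C
  ∧I⇒   : ∀ {A B C} → ⊢WFD A ⇒ B → ⊢WFD A ⇒ C → ⊢WFD A ⇒ (B ∧ C)
  ∨E⇒   : ∀ {A B C} → ⊢WFD A ⇒ C → ⊢WFD B ⇒ C → ⊢WFD (A ∨ B) ⇒ C
  ∧I    : ∀ {A B} → ⊢WFD A → ⊢WFD B → ⊢WFD A ∧ B
  cong⇒ : ∀ {A B C D} → ⊢WFD A ⟺ B → ⊢WFD C ⟺ D →
          ⊢WFD (A ⇒ C) ⟺ (B ⇒ D)

{-# OPTIONS --safe #-}
module Submission where

-- Soundness: reading Γ ⊢G E as ⊢WFD ⋀ Γ ⇒ E, every rule of GWFD is admissible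
-- in WFD; ∨L is distributivity, ⇒LR the congruence rule and ⇒D the axiom D.
-- Completeness: each axiom and rule of WFD is simulated in GWFD. The rules
-- with implicational premises need the inversion [] ⊢G A ⇒ B ⟹ [ A ] ⊢G B,
-- which holds because GWFD is sound for the interpretation ⟦_⟧ that reads
-- A ⇒ B as derivability of [ A ] ⊢G B. Finally Γ ⊢G ⋀ Γ and a cut turn
-- [ ⋀ Γ ] ⊢G E into Γ ⊢G E.

open import Defs
open import Data.Empty using (⊥)
open import Data.Product using (_×_; _,_)
open import Data.Sum using (_⊎_; inj₁; inj₂)
open import Data.List using (List; []; _∷_; [_]; _++_)
open import Data.List.Relation.Unary.All using (All; []; _∷_)
open import Data.List.Relation.Unary.All.Properties using (++⁻ˡ; ++⁻ʳ)
open import Data.List.Relation.Unary.Any using (here; there)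
open import Data.List.Membership.Propositional using (_∈_)
open import Data.List.Membership.Propositional.Properties using (∈-++⁺ˡ; ∈-++⁺ʳ)
open import Data.List.Relation.Binary.Subset.Propositional using (_⊆_)
open import Data.List.Relation.Binary.Permutation.Propositional using (↭-refl; ↭-swap; ↭-sym)
open import Data.List.Relation.Binary.Permutation.Propositional.Properties
  using (All-resp-↭; ∈-resp-↭; ++-comm; ++-identityʳ)
open import Function.Bundles using (_⇔_; mk⇔)
open import Relation.Binary.PropositionalEquality using (refl)

⟦_⟧ : Formula → Set
⟦ atom p ⟧ = ⊥
⟦ ⊥′ ⟧     = ⊥
⟦ A ∧ B ⟧  = ⟦ A ⟧ × ⟦ B ⟧
⟦ A ∨ B ⟧  = ⟦ A ⟧ ⊎ ⟦ B ⟧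
⟦ A ⇒ B ⟧  = [ A ] ⊢G B

⊢G-sound-⟦⟧ : ∀ {Γ E} → Γ ⊢G E → All ⟦_⟧ Γ → ⟦ E ⟧
⊢G-sound-⟦⟧ (perm p d) ρ = ⊢G-sound-⟦⟧ d (All-resp-↭ (↭-sym p) ρ)
⊢G-sound-⟦⟧ ax (a ∷ _) = a
⊢G-sound-⟦⟧ ⊥L (() ∷ _)
⊢G-sound-⟦⟧ (∧L d) ((a , b) ∷ ρ) = ⊢G-sound-⟦⟧ d (a ∷ b ∷ ρ)
⊢G-sound-⟦⟧ (∧R d e) ρ = ⊢G-sound-⟦⟧ d ρ , ⊢G-sound-⟦⟧ e ρ
⊢G-sound-⟦⟧ (∨L d e) (inj₁ a ∷ ρ) = ⊢G-sound-⟦⟧ d (a ∷ ρ)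
⊢G-sound-⟦⟧ (∨L d e) (inj₂ b ∷ ρ) = ⊢G-sound-⟦⟧ e (b ∷ ρ)
⊢G-sound-⟦⟧ (∨R₁ d) ρ = inj₁ (⊢G-sound-⟦⟧ d ρ)
⊢G-sound-⟦⟧ (∨R₂ d) ρ = inj₂ (⊢G-sound-⟦⟧ d ρ)
⊢G-sound-⟦⟧ (⇒R d) ρ = d
⊢G-sound-⟦⟧ (⇒LR _ ba cd _) (ac ∷ _) = cut (cut ba ac) cd
⊢G-sound-⟦⟧ (⇒D d e) ρ = ∨L (⊢G-sound-⟦⟧ d ρ) (⊢G-sound-⟦⟧ e ρ)
⊢G-sound-⟦⟧ (cut {Γ = Γ} d e) ρ =
  ⊢G-sound-⟦⟧ e (⊢G-sound-⟦⟧ d (++⁻ˡ Γ ρ) ∷ ++⁻ʳ Γ ρ)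

⊢G-closed-⟦⟧ : ∀ {F} → [] ⊢G F → ⟦ F ⟧
⊢G-closed-⟦⟧ d = ⊢G-sound-⟦⟧ d []

⇒R-inv : ∀ {A B} → [] ⊢G A ⇒ B → [ A ] ⊢G B
⇒R-inv = ⊢G-closed-⟦⟧

exchange : ∀ {A B Γ C} → A ∷ B ∷ Γ ⊢G C → B ∷ A ∷ Γ ⊢G C
exchange {A} {B} = perm (↭-swap A B ↭-refl)

⊢G-id : ∀ A Γ → A ∷ Γ ⊢G A
⊢G-id (atom p) Γ = ax
⊢G-id ⊥′      Γ = ⊥L
⊢G-id (A ∧ B) Γ = ∧L (∧R (⊢G-id A (B ∷ Γ)) (exchange (⊢G-id B (A ∷ Γ))))
⊢G-id (A ∨ B) Γ = ∨L (∨R₁ (⊢G-id A Γ)) (∨R₂ (⊢G-id B Γ))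
⊢G-id (A ⇒ B) Γ = ⇒LR (⊢G-id A []) (⊢G-id A []) (⊢G-id B []) (⊢G-id B [])

weaken : ∀ {Γ D} A → Γ ⊢G D → A ∷ Γ ⊢G D
weaken {Γ} {D} A d = perm (++-comm Γ [ A ]) (cut d (⊢G-id D [ A ]))

⊢G-pair : ∀ A B → B ∷ A ∷ [] ⊢G A ∧ B
⊢G-pair A B = ∧R (exchange (⊢G-id A [ B ])) (⊢G-id B [ A ])

⊢G-⋀ : ∀ Γ → Γ ⊢G ⋀ Γ
⊢G-⋀ []          = ⇒R ⊥L
⊢G-⋀ (A ∷ [])     = ⊢G-id A []
⊢G-⋀ (A ∷ B ∷ Γ)  = ∧R (⊢G-id A (B ∷ Γ)) (weaken A (⊢G-⋀ (B ∷ Γ)))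

⊢WFD⇒⊢G : ∀ {F} → ⊢WFD F → [] ⊢G F
⊢WFD⇒⊢G (a∨₁ {A})         = ⇒R (∨R₁ (⊢G-id A []))
⊢WFD⇒⊢G (a∨₂ {B = B})     = ⇒R (∨R₂ (⊢G-id B []))
⊢WFD⇒⊢G (a∧₁ {A} {B})     = ⇒R (∧L (⊢G-id A [ B ]))
⊢WFD⇒⊢G (a∧₂ {A} {B})     = ⇒R (∧L (exchange (⊢G-id B [ A ])))
⊢WFD⇒⊢G (adist {A} {B} {C}) =
  ⇒R (∧L (exchange (∨L (∨R₁ (⊢G-pair A B)) (∨R₂ (⊢G-pair A C)))))
⊢WFD⇒⊢G (aid {A})         = ⇒R (⊢G-id A [])
⊢WFD⇒⊢G a⊥                = ⇒R ⊥L
⊢WFD⇒⊢G (aD {A} {B} {C})  =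
  ⇒R (∧L (⇒D (⊢G-id (A ⇒ C) [ B ⇒ C ]) (exchange (⊢G-id (B ⇒ C) [ A ⇒ C ]))))
⊢WFD⇒⊢G (mp a ab)         = cut (⊢WFD⇒⊢G a) (⇒R-inv (⊢WFD⇒⊢G ab))
⊢WFD⇒⊢G (weak {A} {B} a)  = ⇒R (cut (⊢WFD⇒⊢G a) (⊢G-id A [ B ]))
⊢WFD⇒⊢G (trans ab bc)     = ⇒R (cut (⇒R-inv (⊢WFD⇒⊢G ab)) (⇒R-inv (⊢WFD⇒⊢G bc)))
⊢WFD⇒⊢G (∧I⇒ ab ac)       = ⇒R (∧R (⇒R-inv (⊢WFD⇒⊢G ab)) (⇒R-inv (⊢WFD⇒⊢G ac)))
⊢WFD⇒⊢G (∨E⇒ ac bc)       = ⇒R (∨L (⇒R-inv (⊢WFD⇒⊢G ac)) (⇒R-inv (⊢WFD⇒⊢G bc)))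
⊢WFD⇒⊢G (∧I a b)          = ∧R (⊢WFD⇒⊢G a) (⊢WFD⇒⊢G b)
⊢WFD⇒⊢G (cong⇒ A⟺B C⟺D)
  with (ab , ba) ← ⊢G-closed-⟦⟧ (⊢WFD⇒⊢G A⟺B)
     | (cd , dc) ← ⊢G-closed-⟦⟧ (⊢WFD⇒⊢G C⟺D)
  = ∧R (⇒R (⇒LR ab ba cd dc)) (⇒R (⇒LR ba ab dc cd))

⋀-proj : ∀ {X} Γ → X ∈ Γ → ⊢WFD ⋀ Γ ⇒ X
⋀-proj (A ∷ [])     (here refl) = aid
⋀-proj (A ∷ B ∷ Γ)  (here refl) = a∧₁
⋀-proj (A ∷ B ∷ Γ)  (there X∈)  = trans a∧₂ (⋀-proj (B ∷ Γ) X∈)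

⋀-intro : ∀ {A} Δ → (∀ {X} → X ∈ Δ → ⊢WFD A ⇒ X) → ⊢WFD A ⇒ ⋀ Δ
⋀-intro []          f = weak aid
⋀-intro (B ∷ [])     f = f (here refl)
⋀-intro (B ∷ C ∷ Δ)  f = ∧I⇒ (f (here refl)) (⋀-intro (C ∷ Δ) (λ X∈ → f (there X∈)))

⋀-mono : ∀ Γ Δ → Δ ⊆ Γ → ⊢WFD ⋀ Γ ⇒ ⋀ Δ
⋀-mono Γ Δ Δ⊆Γ = ⋀-intro Δ (λ X∈ → ⋀-proj Γ (Δ⊆Γ X∈))

⋀-uncons : ∀ X Γ → ⊢WFD ⋀ (X ∷ Γ) ⇒ ⋀ Γ ∧ X
⋀-uncons X Γ = ∧I⇒ (⋀-mono (X ∷ Γ) Γ there) (⋀-proj (X ∷ Γ) (here refl))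

⋀-cons : ∀ X Γ → ⊢WFD ⋀ Γ ∧ X ⇒ ⋀ (X ∷ Γ)
⋀-cons X Γ = ⋀-intro (X ∷ Γ) λ { (here refl) → a∧₂ ; (there X∈) → trans a∧₁ (⋀-proj Γ X∈) }

⟺-to : ∀ {A B} → ⊢WFD A ⟺ B → ⊢WFD A ⇒ B
⟺-to A⟺B = mp A⟺B a∧₁

⊢G⇒⊢WFD : ∀ {Γ E} → Γ ⊢G E → ⊢WFD ⋀ Γ ⇒ E
⊢G⇒⊢WFD (perm {Γ} {Δ} p d) = trans (⋀-mono Δ Γ (∈-resp-↭ p)) (⊢G⇒⊢WFD d)
⊢G⇒⊢WFD (ax {p} {Γ})       = ⋀-proj (atom p ∷ Γ) (here refl)
⊢G⇒⊢WFD (⊥L {Γ})           = trans (⋀-proj (⊥′ ∷ Γ) (here refl)) a⊥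
⊢G⇒⊢WFD (∧L {A} {B} {Γ} d) = trans (⋀-intro (A ∷ B ∷ Γ) unpair) (⊢G⇒⊢WFD d)
  where
  A∧B : ⊢WFD ⋀ ((A ∧ B) ∷ Γ) ⇒ A ∧ B
  A∧B = ⋀-proj ((A ∧ B) ∷ Γ) (here refl)
  unpair : ∀ {X} → X ∈ A ∷ B ∷ Γ → ⊢WFD ⋀ ((A ∧ B) ∷ Γ) ⇒ X
  unpair (here refl)         = trans A∧B a∧₁
  unpair (there (here refl)) = trans A∧B a∧₂
  unpair (there (there X∈))  = ⋀-proj ((A ∧ B) ∷ Γ) (there X∈)
⊢G⇒⊢WFD (∧R d e)           = ∧I⇒ (⊢G⇒⊢WFD d) (⊢G⇒⊢WFD e)
⊢G⇒⊢WFD (∨L {A} {B} {Γ} d e) =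
  trans (⋀-uncons (A ∨ B) Γ)
    (trans adist (∨E⇒ (trans (⋀-cons A Γ) (⊢G⇒⊢WFD d))
                      (trans (⋀-cons B Γ) (⊢G⇒⊢WFD e))))
⊢G⇒⊢WFD (∨R₁ d)            = trans (⊢G⇒⊢WFD d) a∨₁
⊢G⇒⊢WFD (∨R₂ d)            = trans (⊢G⇒⊢WFD d) a∨₂
⊢G⇒⊢WFD (⇒R d)             = weak (⊢G⇒⊢WFD d)
⊢G⇒⊢WFD (⇒LR {Γ} {A} {B} {C} {D} ab ba cd dc) =
  trans (⋀-proj ((A ⇒ C) ∷ Γ) (here refl))
    (⟺-to (cong⇒ (∧I (⊢G⇒⊢WFD ab) (⊢G⇒⊢WFD ba)) (∧I (⊢G⇒⊢WFD cd) (⊢G⇒⊢WFD dc))))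
⊢G⇒⊢WFD (⇒D d e)           = trans (∧I⇒ (⊢G⇒⊢WFD d) (⊢G⇒⊢WFD e)) aD
⊢G⇒⊢WFD (cut {Γ} {Γ′} {D} d e) =
  trans (∧I⇒ (⋀-mono (Γ ++ Γ′) Γ′ (∈-++⁺ʳ Γ))
             (trans (⋀-mono (Γ ++ Γ′) Γ ∈-++⁺ˡ) (⊢G⇒⊢WFD d)))
    (trans (⋀-cons D Γ′) (⊢G⇒⊢WFD e))

⊢WFD⋀⇒⊢G : ∀ Γ {E} → ⊢WFD ⋀ Γ ⇒ E → Γ ⊢G E
⊢WFD⋀⇒⊢G Γ h = perm (++-identityʳ Γ) (cut (⊢G-⋀ Γ) (⇒R-inv (⊢WFD⇒⊢G h)))

mainTheorem14 : (Γ : List Formula) (E : Formula) →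
    (Γ ⊢G E) ⇔ (⊢WFD (⋀ Γ ⇒ E))
mainTheorem14 Γ E = mk⇔ ⊢G⇒⊢WFD (⊢WFD⋀⇒⊢G Γ)
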